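{- The thinness of an $n$-vertex tree $T$ is $\textup{O}(\log(n))$. In fact $\mathrm{thin}(T) \leq \log_3(n+2)$.
   Context: A graph $G$ is $k$-thin if there exist a strict total order $\prec$ on $V(G)$ and a partition of $V(G)$ into $k$ classes such that for all $u \prec v \prec w$ with $u,v$ in the same class and $(u,w)\in E(G)$, also $(v,w)\in E(G)$; the thinness $\mathrm{thin}(G)$ is the minimum such $k$. -}

module Defs where

open import Data.Nat using (ℕ; suc; _≤_; _^_; _+_)
open import Data.Fin using (Fin)
open import Data.List using (List; []; _∷_; length; last)
open import Data.List.Relation.Unary.Unique.Propositional using (Unique)
open import Data.List.Relation.Unary.Linked using (Linked)
open import Data.Maybe using (Maybe; just; nothing)
open import Data.Product using (Σ; ∃; ∃-syntax; _×_)
open import Data.Empty using (⊥)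
open import Relation.Nullary using (¬_)
open import Relation.Binary.PropositionalEquality using (_≡_)
open import Relation.Binary.Structures using (IsStrictTotalOrder)
open import Relation.Binary.Construct.Closure.ReflexiveTransitive using (Star)

record Graph (n : ℕ) : Set₁ where
  field
    Adj   : Fin n → Fin n → Set
    sym   : ∀ {u v} → Adj u v → Adj v u
    irrefl : ∀ {u} → ¬ Adj u u
open Graph public

Connected : ∀ {n} → Graph n → Set
Connected G = ∀ u v → Star (Adj G) u v

record Cycle {n} (G : Graph n) : Set where
  field
    x₀     : Fin n
    rest   : List (Fin n)
    long   : 2 ≤ length rest
    unique : Unique (x₀ ∷ rest)
    linked : Linked (Adj G) (x₀ ∷ rest)
    closes : ∀ y → last (x₀ ∷ rest) ≡ just y → Adj G y x₀

Acyclic : ∀ {n} → Graph n → Set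
Acyclic G = ¬ Cycle G

IsTree : ∀ {n} → Graph n → Set
IsTree {n} G = 1 ≤ n × Connected G × Acyclic G

-- G is k-thin: there is a strict total order ≺ on V(G) and a partition of
-- V(G) into k classes (class c v ∈ Fin k; classes may be empty) such that
-- for u ≺ v ≺ w with u, v in the same class and uw ∈ E, also vw ∈ E.
IsThin : ∀ {n} → Graph n → ℕ → Set₁
IsThin {n} G k =
  Σ (Fin n → Fin n → Set) λ _≺_ →
  IsStrictTotalOrder _≡_ _≺_ ×
  Σ (Fin n → Fin k) λ c →
    ∀ u v w → u ≺ v → v ≺ w → c u ≡ c v → Adj G u w → Adj G v w

-- thin(G) ≤ log₃(m), i.e. the minimum k with G k-thin satisfies 3^k ≤ m.
ThinnessLogBound : ∀ {n} → Graph n → ℕ → Set₁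
ThinnessLogBound G m = ∃[ k ] (IsThin G k × 3 ^ k ≤ m)

-- Let M = 3^(k+1) − 3 and let T be a tree with at most 3(M + 2) vertices. Call a neighbour x
-- of p heavy if some branch at x away from p has more than M vertices. No vertex has three
-- branches of more than M + 1 vertices, so T has a path, the spine, whose vertices have no heavy
-- neighbours off the spine. Lay T out along the spine: for each spine vertex p, every off-spine
-- neighbour x in class 0 followed by the branches below x, each laid out recursively with k
-- classes shifted to 1 … k, and then p itself in class 0. A branch is only adjacent to its x,
-- which precedes it, and the class-0 vertices between consecutive spine vertices are neighbours
-- of the later one, so this layout is consistent with k + 1 classes. Hence n + 3 ≤ 3^(k+1)
-- forces thin(T) ≤ k, and choosing 3^k ≤ n + 2 < 3^(k+1) gives the bound.

module Submission where

open import Defs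
open import Data.Nat using (ℕ; zero; suc; _≤_; _<_; _+_; _*_; _^_; _∸_; _≤?_; _<?_; s≤s; z≤n)
open import Data.Nat.Properties
  using (≤-refl; ≤-reflexive; ≤-trans; ≤-pred; n≤1+n; m≤m+n; m≤n+m; +-mono-≤; +-monoˡ-≤; +-cancelʳ-≤; +-suc;
         *-monoʳ-≤; m∸n+n≡m; m^n>0; <⇒≱; ≤⇒≯; ≮⇒≥)
open import Data.Nat.ListAction using (sum)
open import Data.Nat.Tactic.RingSolver using (solve-∀)
open import Data.Fin using (Fin; zero; suc; fromℕ<)
open import Data.Fin.Properties using (_≟_; suc-injective; injective⇒≤; toℕ<n)
open import Data.List using (List; []; _∷_; _++_; map; concatMap; length; last; head; lookup; filter; allFin; _ʳ++_)
open import Data.List.Properties using (length-++; length-map; last-map; ++-assoc; map-++; map-concatMap; map-id)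
open import Data.List.Membership.Propositional using (_∈_; _∉_; find; lose)
open import Data.List.Membership.Propositional.Properties
  using (∈-++⁺ˡ; ∈-++⁺ʳ; ∈-++⁻; ∈-∃++; ∈-map⁺; ∈-map⁻; ∈-concatMap⁺; ∈-concatMap⁻; ∈-filter⁺; ∈-filter⁻;
         ∈-lookup; ∈-allFin; ∉[])
open import Data.List.Relation.Unary.Any using (Any; here; there; any?; index)
open import Data.List.Relation.Unary.Any.Properties using (lookup-index)
open import Data.List.Relation.Unary.All using (All; []; _∷_)
open import Data.List.Relation.Unary.All.Properties using (¬Any⇒All¬)
open import Data.List.Relation.Unary.AllPairs using ([]; _∷_)
open import Data.List.Relation.Unary.Unique.Propositional using (Unique)
open import Data.List.Relation.Unary.Unique.Propositional.Properties as Unique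
  using (Unique[x∷xs]⇒x∉xs; ++⁺; filter⁺; allFin⁺)
open import Data.List.Relation.Unary.Linked using (Linked; []; [-]; _∷_)
import Data.List.Relation.Unary.Linked.Properties as Linked
open import Data.Maybe using (Maybe; just; nothing)
import Data.Maybe as Maybe
open import Data.Maybe.Properties using (just-injective)
open import Data.Product using (Σ; ∃; _×_; _,_; proj₁; proj₂)
import Data.Product as Product
open import Data.Sum using (_⊎_; inj₁; inj₂)
open import Data.Empty using (⊥; ⊥-elim)
open import Function using (_∘_; id)
open import Relation.Nullary using (¬_; yes; no; Dec)
open import Relation.Nullary.Decidable using (¬?)
open import Relation.Binary.PropositionalEquality as ≡ using (_≡_; _≢_; refl; cong; subst; subst₂)
open import Relation.Binary.Structures using (IsStrictTotalOrder)
open import Relation.Binary.Definitions using (tri<; tri≈; tri>)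
open import Relation.Binary.Construct.Closure.ReflexiveTransitive as Star using (Star; ε; _◅_; _◅◅_)

module _ {A : Set} where

  unique-tail : ∀ {x : A} {xs} → Unique (x ∷ xs) → Unique xs
  unique-tail (_ ∷ u) = u

  unique-head-≢ : ∀ {x : A} {xs x′} → Unique (x ∷ xs) → x′ ∈ xs → x ≢ x′
  unique-head-≢ u x′∈ refl = Unique[x∷xs]⇒x∉xs u x′∈

  unique-++⁻ˡ : ∀ (xs : List A) {ys} → Unique (xs ++ ys) → Unique xs
  unique-++⁻ˡ [] u = []
  unique-++⁻ˡ (x ∷ xs) (x∉ ∷ u) = prefix xs x∉ ∷ unique-++⁻ˡ xs u
    where
    prefix : ∀ {P : A → Set} (zs : List A) {ws} → All P (zs ++ ws) → All P zs
    prefix [] _ = []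
    prefix (z ∷ zs) (p ∷ ps) = p ∷ prefix zs ps

  unique-++⁻ʳ : ∀ (xs : List A) {ys} → Unique (xs ++ ys) → Unique ys
  unique-++⁻ʳ [] u = u
  unique-++⁻ʳ (x ∷ xs) (_ ∷ u) = unique-++⁻ʳ xs u

  linked-++⁻ˡ : ∀ {R : A → A → Set} (xs : List A) {ys} → Linked R (xs ++ ys) → Linked R xs
  linked-++⁻ˡ [] l = []
  linked-++⁻ˡ (x ∷ []) l = [-]
  linked-++⁻ˡ (x ∷ y ∷ xs) (r ∷ l) = r ∷ linked-++⁻ˡ (y ∷ xs) l

  linked-++⁻ʳ : ∀ {R : A → A → Set} (xs : List A) {ys} → Linked R (xs ++ ys) → Linked R ys
  linked-++⁻ʳ [] l = l
  linked-++⁻ʳ (x ∷ []) [-] = []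
  linked-++⁻ʳ (x ∷ []) (_ ∷ l) = l
  linked-++⁻ʳ (x ∷ y ∷ xs) (_ ∷ l) = linked-++⁻ʳ (y ∷ xs) l

  last-++ : ∀ (xs : List A) {a} ys → last (xs ++ a ∷ ys) ≡ last (a ∷ ys)
  last-++ [] ys = refl
  last-++ (x ∷ []) ys = refl
  last-++ (x ∷ y ∷ xs) ys = last-++ (y ∷ xs) ys

  last-∈ : ∀ {xs : List A} {a} → last xs ≡ just a → a ∈ xs
  last-∈ {x ∷ []} refl = here refl
  last-∈ {x ∷ y ∷ xs} e = there (last-∈ {y ∷ xs} e)

  lookup-injective : ∀ {xs : List A} → Unique xs → ∀ {i j} → lookup xs i ≡ lookup xs j → i ≡ j
  lookup-injective {x ∷ xs} u {zero} {zero} e = refl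
  lookup-injective {x ∷ xs} u {zero} {suc j} e = ⊥-elim (Unique[x∷xs]⇒x∉xs u (subst (_∈ xs) (≡.sym e) (∈-lookup j)))
  lookup-injective {x ∷ xs} u {suc i} {zero} e = ⊥-elim (Unique[x∷xs]⇒x∉xs u (subst (_∈ xs) e (∈-lookup i)))
  lookup-injective {x ∷ xs} u {suc i} {suc j} e = cong suc (lookup-injective (unique-tail u) e)

module _ {A B : Set} (f : A → List B) where

  concatMap-∈⁻ : ∀ {xs y} → y ∈ concatMap f xs → ∃ λ x → x ∈ xs × y ∈ f x
  concatMap-∈⁻ y∈ = find (∈-concatMap⁻ f y∈)

  ∈-concatMap : ∀ {xs x y} → x ∈ xs → y ∈ f x → y ∈ concatMap f xs
  ∈-concatMap x∈ y∈ = ∈-concatMap⁺ f (lose x∈ y∈)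

  length-∈-concatMap : ∀ {xs x} → x ∈ xs → length (f x) ≤ length (concatMap f xs)
  length-∈-concatMap {x ∷ xs} (here refl) rewrite length-++ (f x) {concatMap f xs} = m≤m+n _ _
  length-∈-concatMap {x ∷ xs} (there x∈) rewrite length-++ (f x) {concatMap f xs} =
    ≤-trans (length-∈-concatMap x∈) (m≤n+m _ _)

  length-concatMap : ∀ xs → length (concatMap f xs) ≡ sum (map (length ∘ f) xs)
  length-concatMap [] = refl
  length-concatMap (x ∷ xs) = ≡.trans (length-++ (f x)) (cong (length (f x) +_) (length-concatMap xs))

  unique-concatMap : ∀ {xs} → Unique xs → (∀ {x} → x ∈ xs → Unique (f x)) →
    (∀ {x x′ y} → x ∈ xs → x′ ∈ xs → x ≢ x′ → y ∈ f x → y ∈ f x′ → ⊥) → Unique (concatMap f xs)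
  unique-concatMap {[]} _ _ _ = []
  unique-concatMap {x ∷ xs} u uf disjoint =
    ++⁺ (uf (here refl))
        (unique-concatMap (unique-tail u) (uf ∘ there) (λ x∈ x′∈ → disjoint (there x∈) (there x′∈)))
        λ (y∈fx , y∈rest) → let x′ , x′∈ , y∈fx′ = concatMap-∈⁻ y∈rest in
          disjoint (here refl) (there x′∈) (unique-head-≢ u x′∈) y∈fx y∈fx′

concatMap-cong-∈ : ∀ {A B : Set} {f g : A → List B} (xs : List A) → (∀ {x} → x ∈ xs → f x ≡ g x) →
                   concatMap f xs ≡ concatMap g xs
concatMap-cong-∈ [] _ = refl
concatMap-cong-∈ (x ∷ xs) f≡g = ≡.cong₂ _++_ (f≡g (here refl)) (concatMap-cong-∈ xs (f≡g ∘ there))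

unique⇒length≤ : ∀ {n} {xs : List (Fin n)} → Unique xs → length xs ≤ n
unique⇒length≤ u = injective⇒≤ (lookup-injective u)

module _ {A : Set} where

  data Before : List A → A → A → Set where
    here  : ∀ {x v xs} → v ∈ xs → Before (x ∷ xs) x v
    there : ∀ {x u v xs} → Before xs u v → Before (x ∷ xs) u v

  data Before₃ : List A → A → A → A → Set where
    here  : ∀ {x v w xs} → Before xs v w → Before₃ (x ∷ xs) x v w
    there : ∀ {x u v w xs} → Before₃ xs u v w → Before₃ (x ∷ xs) u v w

  before-∈ˡ : ∀ {xs u v} → Before xs u v → u ∈ xs
  before-∈ˡ (here _) = here refl
  before-∈ˡ (there b) = there (before-∈ˡ b)

  before-∈ʳ : ∀ {xs u v} → Before xs u v → v ∈ xs
  before-∈ʳ (here v∈xs) = there v∈xs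
  before-∈ʳ (there b) = there (before-∈ʳ b)

  before-∷-∈ʳ : ∀ {x xs u v} → Before (x ∷ xs) u v → v ∈ xs
  before-∷-∈ʳ (here v∈xs) = v∈xs
  before-∷-∈ʳ (there b) = before-∈ʳ b

  before₃⇒before : ∀ {xs u v w} → Before₃ xs u v w → Before xs u v
  before₃⇒before (here b) = here (before-∈ˡ b)
  before₃⇒before (there b) = there (before₃⇒before b)

  before₃-∈ᵐ : ∀ {xs u v w} → Before₃ xs u v w → v ∈ xs
  before₃-∈ᵐ (here b) = there (before-∈ˡ b)
  before₃-∈ᵐ (there b) = there (before₃-∈ᵐ b)

  before-++⁻ : ∀ xs {ys u v} → Before (xs ++ ys) u v →
               Before xs u v ⊎ (u ∈ xs × v ∈ ys) ⊎ Before ys u v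
  before-++⁻ [] b = inj₂ (inj₂ b)
  before-++⁻ (x ∷ xs) (here v∈) with ∈-++⁻ xs v∈
  ... | inj₁ v∈xs = inj₁ (here v∈xs)
  ... | inj₂ v∈ys = inj₂ (inj₁ (here refl , v∈ys))
  before-++⁻ (x ∷ xs) (there b) with before-++⁻ xs b
  ... | inj₁ b′ = inj₁ (there b′)
  ... | inj₂ (inj₁ (u∈xs , v∈ys)) = inj₂ (inj₁ (there u∈xs , v∈ys))
  ... | inj₂ (inj₂ b′) = inj₂ (inj₂ b′)

  before₃-++⁻ : ∀ xs {ys u v w} → Before₃ (xs ++ ys) u v w →
                Before₃ xs u v w ⊎ (Before xs u v × w ∈ ys) ⊎ (u ∈ xs × Before ys v w) ⊎ Before₃ ys u v w
  before₃-++⁻ [] b = inj₂ (inj₂ (inj₂ b))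
  before₃-++⁻ (x ∷ xs) (here b) with before-++⁻ xs b
  ... | inj₁ b′ = inj₁ (here b′)
  ... | inj₂ (inj₁ (v∈xs , w∈ys)) = inj₂ (inj₁ (here v∈xs , w∈ys))
  ... | inj₂ (inj₂ b′) = inj₂ (inj₂ (inj₁ (here refl , b′)))
  before₃-++⁻ (x ∷ xs) (there b) with before₃-++⁻ xs b
  ... | inj₁ b′ = inj₁ (there b′)
  ... | inj₂ (inj₁ (b′ , w∈ys)) = inj₂ (inj₁ (there b′ , w∈ys))
  ... | inj₂ (inj₂ (inj₁ (u∈xs , b′))) = inj₂ (inj₂ (inj₁ (there u∈xs , b′)))
  ... | inj₂ (inj₂ (inj₂ b′)) = inj₂ (inj₂ (inj₂ b′))

  before-irrefl : ∀ {xs u} → Unique xs → ¬ Before xs u u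
  before-irrefl u (here u∈xs) = Unique[x∷xs]⇒x∉xs u u∈xs
  before-irrefl u (there b) = before-irrefl (unique-tail u) b

  before-asym : ∀ {xs u v} → Unique xs → Before xs u v → ¬ Before xs v u
  before-asym u (here v∈xs) (here u∈xs) = Unique[x∷xs]⇒x∉xs u u∈xs
  before-asym u (here v∈xs) (there b) = Unique[x∷xs]⇒x∉xs u (before-∈ʳ b)
  before-asym u (there b) (here u∈xs) = Unique[x∷xs]⇒x∉xs u (before-∈ʳ b)
  before-asym u (there b) (there b′) = before-asym (unique-tail u) b b′

  before₃ : ∀ {xs u v w} → Unique xs → Before xs u v → Before xs v w → Before₃ xs u v w
  before₃ u (here u∈xs) (here _) = ⊥-elim (Unique[x∷xs]⇒x∉xs u u∈xs)
  before₃ u (here _) (there b) = here b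
  before₃ u (there b) (here _) = ⊥-elim (Unique[x∷xs]⇒x∉xs u (before-∈ʳ b))
  before₃ u (there b) (there b′) = there (before₃ (unique-tail u) b b′)

  before-trans : ∀ {xs u v w} → Unique xs → Before xs u v → Before xs v w → Before xs u w
  before-trans u b b′ = outer (before₃ u b b′)
    where
    outer : ∀ {xs u v w} → Before₃ xs u v w → Before xs u w
    outer (here b) = here (before-∈ʳ b)
    outer (there b) = there (outer b)

  before-connex : ∀ {xs u v} → u ∈ xs → v ∈ xs → u ≢ v → Before xs u v ⊎ Before xs v u
  before-connex (here refl) (here refl) u≢v = ⊥-elim (u≢v refl)
  before-connex (here refl) (there v∈xs) _ = inj₁ (here v∈xs)
  before-connex (there u∈xs) (here refl) _ = inj₂ (here u∈xs)
  before-connex (there u∈xs) (there v∈xs) u≢v with before-connex u∈xs v∈xs u≢v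
  ... | inj₁ b = inj₁ (there b)
  ... | inj₂ b = inj₂ (there b)

module _ {A B : Set} (f : A → B) where

  before-map⁻ : ∀ {xs u v} → Before (map f xs) u v → ∃ λ a → ∃ λ b → Before xs a b × f a ≡ u × f b ≡ v
  before-map⁻ {x ∷ xs} (here v∈) with ∈-map⁻ f v∈
  ... | b , b∈xs , refl = x , b , here b∈xs , refl , refl
  before-map⁻ {x ∷ xs} (there o) with before-map⁻ o
  ... | a , b , o′ , e₁ , e₂ = a , b , there o′ , e₁ , e₂

  before₃-map⁻ : ∀ {xs u v w} → Before₃ (map f xs) u v w →
                 ∃ λ a → ∃ λ b → ∃ λ c → Before₃ xs a b c × f a ≡ u × f b ≡ v × f c ≡ w
  before₃-map⁻ {x ∷ xs} (here o) with before-map⁻ o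
  ... | b , c , o′ , refl , refl = x , b , c , here o′ , refl , refl , refl
  before₃-map⁻ {x ∷ xs} (there o) with before₃-map⁻ o
  ... | a , b , c , o′ , e₁ , e₂ , e₃ = a , b , c , there o′ , e₁ , e₂ , e₃

-- A layout lists vertices in the order ≺ together with their classes.
Layout : Set → ℕ → Set
Layout V k = List (V × Fin k)

vertices : ∀ {V k} → Layout V k → List V
vertices = map proj₁

module _ {V : Set} (E : V → V → Set) where

  Consistent : ∀ {k} → Layout V k → Set
  Consistent L = ∀ {u v w} → Before₃ L u v w → proj₂ u ≡ proj₂ v → E (proj₁ u) (proj₁ w) → E (proj₁ v) (proj₁ w)

  consistent-[] : ∀ {k} → Consistent {k} []
  consistent-[] ()

  consistent-++ : ∀ {k} {xs ys : Layout V k} → Consistent xs → Consistent ys →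
                  (∀ {a b} → a ∈ xs → b ∈ ys → ¬ E (proj₁ a) (proj₁ b)) → Consistent (xs ++ ys)
  consistent-++ {xs = xs} cxs cys no-edge b e uw with before₃-++⁻ xs b
  ... | inj₁ b′ = cxs b′ e uw
  ... | inj₂ (inj₁ (b′ , w∈)) = ⊥-elim (no-edge (before-∈ˡ b′) w∈ uw)
  ... | inj₂ (inj₂ (inj₁ (u∈ , b′))) = ⊥-elim (no-edge u∈ (before-∈ʳ b′) uw)
  ... | inj₂ (inj₂ (inj₂ b′)) = cys b′ e uw

  consistent-∷ : ∀ {k} {s : V} {c : Fin k} {L} → Consistent L →
                (∀ {v w} → Before L v w → proj₂ v ≡ c → E s (proj₁ w) → E (proj₁ v) (proj₁ w)) →
                Consistent ((s , c) ∷ L)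
  consistent-∷ cL first (here b) e uw = first b (≡.sym e) uw
  consistent-∷ cL first (there b) = cL b

  consistent-concatMap : ∀ {A : Set} {k} (f : A → Layout V k) {xs} → Unique xs →
    (∀ {x} → x ∈ xs → Consistent (f x)) →
    (∀ {x x′ a b} → x ∈ xs → x′ ∈ xs → x ≢ x′ → a ∈ f x → b ∈ f x′ → ¬ E (proj₁ a) (proj₁ b)) →
    Consistent (concatMap f xs)
  consistent-concatMap f {[]} _ _ _ = consistent-[]
  consistent-concatMap f {x ∷ xs} u c no-edge =
    consistent-++ (c (here refl)) (consistent-concatMap f (unique-tail u) (c ∘ there)
                                     (λ x∈ x′∈ → no-edge (there x∈) (there x′∈)))
      λ a∈ b∈ → let x′ , x′∈ , b∈′ = concatMap-∈⁻ f b∈ in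
        no-edge (here refl) (there x′∈) (unique-head-≢ u x′∈) a∈ b∈′

record IsLayoutOf {V : Set} (E : V → V → Set) (X : List V) {k} (L : Layout V k) : Set where
  field
    unique     : Unique (vertices L)
    sound      : ∀ {a} → a ∈ vertices L → a ∈ X
    complete   : ∀ {a} → a ∈ X → a ∈ vertices L
    consistent : Consistent E L

LayoutOf : {V : Set} (E : V → V → Set) (X : List V) (k : ℕ) → Set
LayoutOf {V} E X k = Σ (Layout V k) (IsLayoutOf E X)

vertices-++ : ∀ {V k} (L L′ : Layout V k) → vertices (L ++ L′) ≡ vertices L ++ vertices L′
vertices-++ = map-++ proj₁

vertices-concatMap : ∀ {A V : Set} {k} (f : A → Layout V k) xs →
                     vertices (concatMap f xs) ≡ concatMap (vertices ∘ f) xs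
vertices-concatMap f xs = map-concatMap proj₁ f xs

mapLayout : ∀ {V W k k′} → (V → W) → (Fin k → Fin k′) → Layout V k → Layout W k′
mapLayout f g = map (Product.map f g)

vertices-mapLayout : ∀ {V W k k′} (f : V → W) (g : Fin k → Fin k′) L →
                     vertices (mapLayout f g L) ≡ map f (vertices L)
vertices-mapLayout f g [] = refl
vertices-mapLayout f g (x ∷ L) = cong (f (proj₁ x) ∷_) (vertices-mapLayout f g L)

consistent-mapLayout : ∀ {V W k k′} {E : W → W → Set} (f : V → W) {g : Fin k → Fin k′} {L} →
  (∀ {c c′} → g c ≡ g c′ → c ≡ c′) → Consistent (λ u v → E (f u) (f v)) L → Consistent E (mapLayout f g L)
consistent-mapLayout f {g} g-injective c b e uw with before₃-map⁻ (Product.map f g) b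
... | _ , _ , _ , b′ , refl , refl , refl = c b′ (g-injective e) uw

shift : ∀ {V k} → Layout V k → Layout V (suc k)
shift = mapLayout id suc

vertices-shift : ∀ {V k} (L : Layout V k) → vertices (shift L) ≡ vertices L
vertices-shift L = ≡.trans (vertices-mapLayout id suc L) (map-id (vertices L))

shift≢zero : ∀ {V k} {L : Layout V k} {b} → b ∈ shift L → proj₂ b ≢ zero
shift≢zero b∈ with ∈-map⁻ (Product.map id suc) b∈
... | _ , _ , refl = λ ()

consistent-shift : ∀ {V k} {E : V → V → Set} {L : Layout V k} → Consistent E L → Consistent E (shift L)
consistent-shift = consistent-mapLayout id suc-injective

class-functional : ∀ {V k} {L : Layout V k} {a c c′} →
                   Unique (vertices L) → (a , c) ∈ L → (a , c′) ∈ L → c ≡ c′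
class-functional u (here refl) (here refl) = refl
class-functional u (here refl) (there a∈) = ⊥-elim (Unique[x∷xs]⇒x∉xs u (∈-map⁺ proj₁ a∈))
class-functional u (there a∈) (here refl) = ⊥-elim (Unique[x∷xs]⇒x∉xs u (∈-map⁺ proj₁ a∈))
class-functional u (there a∈) (there a∈′) = class-functional (unique-tail u) a∈ a∈′

layout⇒IsThin : ∀ {n k} (G : Graph n) → LayoutOf (Adj G) (allFin n) k → IsThin G k
layout⇒IsThin {n} {k} G (L , spec) = _≺_ , strictTotal , class , thin
  where
  open IsLayoutOf spec
  covers : ∀ a → a ∈ vertices L
  covers a = complete (∈-allFin a)

  _≺_ : Fin n → Fin n → Set
  u ≺ v = Before (vertices L) u v

  strictTotal : IsStrictTotalOrder _≡_ _≺_
  strictTotal = record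
    { isStrictPartialOrder = record
      { isEquivalence = ≡.isEquivalence
      ; irrefl = λ { refl → before-irrefl unique }
      ; trans = before-trans unique
      ; <-resp-≈ = (λ { refl b → b }) , (λ { refl b → b }) }
    ; compare = compare }
    where
    compare : ∀ u v → _
    compare u v with u ≟ v
    ... | yes refl = tri≈ (before-irrefl unique) refl (before-irrefl unique)
    ... | no u≢v with before-connex (covers u) (covers v) u≢v
    ... | inj₁ b = tri< b u≢v (before-asym unique b)
    ... | inj₂ b = tri> (before-asym unique b) u≢v b

  entry : ∀ a → Σ (Fin k) λ c → (a , c) ∈ L
  entry a with ∈-map⁻ proj₁ (covers a)
  ... | (a , c) , a∈ , refl = c , a∈

  class : Fin n → Fin k
  class a = proj₁ (entry a)

  class-unique : ∀ {a c} → (a , c) ∈ L → class a ≡ c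
  class-unique {a} = class-functional unique (proj₂ (entry a))

  thin : ∀ u v w → u ≺ v → v ≺ w → class u ≡ class v → Adj G u w → Adj G v w
  thin u v w u≺v v≺w same uw with before₃-map⁻ proj₁ (before₃ unique u≺v v≺w)
  ... | (u , cu) , (v , cv) , (w , cw) , b , refl , refl , refl =
    consistent b (≡.trans (≡.sym (class-unique (before-∈ˡ (before₃⇒before b))))
                   (≡.trans same (class-unique (before₃-∈ᵐ b)))) uw

Within : ∀ {V : Set} → (V → V → Set) → List V → V → V → Set
Within E X u v = E u v × u ∈ X × v ∈ X

module Tree {n : ℕ} (T : Graph n) (connected : Connected T) (acyclic : Acyclic T) where

  open import Data.List.Membership.DecPropositional (_≟_ {n}) using (_∈?_)

  V : Set
  V = Fin n

  E : V → V → Set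
  E = Adj T

  E-sym : ∀ {a b} → E a b → E b a
  E-sym = sym T

  E-irrefl : ∀ {a} → ¬ E a a
  E-irrefl = irrefl T

  E⇒≢ : ∀ {a b} → E a b → a ≢ b
  E⇒≢ ab refl = E-irrefl ab

  IsPath : List V → Set
  IsPath xs = Unique xs × Linked E xs

  data Walk : V → V → List V → Set where
    ε   : ∀ {a} → Walk a a []
    _◅_ : ∀ {a b c xs} → E a b → Walk b c xs → Walk a c (b ∷ xs)

  star⇒walk : ∀ {a b} → Star E a b → Σ (List V) (Walk a b)
  star⇒walk ε = [] , ε
  star⇒walk (e ◅ s) = let xs , w = star⇒walk s in _ , e ◅ w

  walk-++ : ∀ {a b c xs ys} → Walk a b xs → Walk b c ys → Walk a c (xs ++ ys)
  walk-++ ε w′ = w′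
  walk-++ (e ◅ w) w′ = e ◅ walk-++ w w′

  walk-reverse : ∀ {a b xs} → Walk a b xs → Σ (List V) λ ys → Walk b a ys × (∀ {y} → y ∈ ys → y ∈ a ∷ xs)
  walk-reverse ε = [] , ε , λ ()
  walk-reverse {a} (e ◅ w) with walk-reverse w
  ... | ys , w′ , ys⊆ = ys ++ a ∷ [] , walk-++ w′ (E-sym e ◅ ε) , ⊆
    where
    ⊆ : ∀ {y} → y ∈ ys ++ a ∷ [] → y ∈ a ∷ _
    ⊆ y∈ with ∈-++⁻ ys y∈
    ... | inj₁ y∈ys = there (ys⊆ y∈ys)
    ... | inj₂ (here refl) = here refl

  linked⇒walk : ∀ {x xs b} → Linked E (x ∷ xs) → last (x ∷ xs) ≡ just b → Walk x b xs
  linked⇒walk {xs = []} _ refl = ε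
  linked⇒walk {xs = y ∷ ys} (e ∷ l) ends = e ◅ linked⇒walk l ends

  -- Cutting out the closed subwalks of a walk leaves a path.
  walk⇒path : ∀ {a b xs} → Walk a b xs →
    Σ (List V) λ ps → IsPath (a ∷ ps) × last (a ∷ ps) ≡ just b × (∀ {y} → y ∈ ps → y ∈ xs)
  walk⇒path ε = [] , ([] ∷ [] , [-]) , refl , λ ()
  walk⇒path {a} (_◅_ {b = b} {xs = xs} e w) with walk⇒path w
  ... | ps , (u , l) , ends , ps⊆ with a ∈? (b ∷ ps)
  ... | no a∉ = b ∷ ps , (¬Any⇒All¬ _ a∉ ∷ u , e ∷ l) , ends , ⊆
    where
    ⊆ : ∀ {y} → y ∈ b ∷ ps → y ∈ b ∷ xs
    ⊆ (here refl) = here refl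
    ⊆ (there y∈) = there (ps⊆ y∈)
  ... | yes a∈ with ∈-∃++ a∈
  ... | pre , post , eq =
    post , (unique-++⁻ʳ pre (subst Unique eq u) , linked-++⁻ʳ pre (subst (Linked E) eq l)) ,
    ≡.trans (≡.sym (last-++ pre post)) (≡.trans (cong last (≡.sym eq)) ends) , ⊆
    where
    ⊆ : ∀ {y} → y ∈ post → y ∈ b ∷ xs
    ⊆ y∈ with subst (_ ∈_) (≡.sym eq) (∈-++⁺ʳ pre (there y∈))
    ... | here refl = here refl
    ... | there y∈ps = there (ps⊆ y∈ps)

  -- A path x₀ z … q … closed by an edge q x₀ contains a cycle.
  ¬back-edge : ∀ {x₀ z zs q} → IsPath (x₀ ∷ z ∷ zs) → q ∈ zs → ¬ E q x₀
  ¬back-edge {x₀} {z} {zs} {q} (u , l) q∈ qx₀ with ∈-∃++ q∈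
  ... | pre , post , refl = acyclic record
    { x₀ = x₀
    ; rest = z ∷ pre ++ q ∷ []
    ; long = s≤s (length≥1 pre)
    ; unique = unique-++⁻ˡ cyc (subst Unique split u)
    ; linked = linked-++⁻ˡ cyc (subst (Linked E) split l)
    ; closes = λ y e → subst (λ t → E t x₀) (just-injective (≡.trans (≡.sym (last-++ (z ∷ pre) [])) e)) qx₀ }
    where
    cyc : List V
    cyc = x₀ ∷ z ∷ pre ++ q ∷ []
    split : x₀ ∷ z ∷ pre ++ q ∷ post ≡ cyc ++ post
    split = cong (λ t → x₀ ∷ z ∷ t) (≡.sym (++-assoc pre (q ∷ []) post))
    length≥1 : ∀ (xs : List V) → 1 ≤ length (xs ++ q ∷ [])
    length≥1 [] = s≤s z≤n
    length≥1 (_ ∷ _) = s≤s z≤n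

  edge-path : ∀ {a b} → E a b → IsPath (a ∷ b ∷ [])
  edge-path ab = ((E⇒≢ ab ∷ []) ∷ [] ∷ []) , ab ∷ [-]

  path-∷ : ∀ {p v w ps} → E p v → p ≢ w → IsPath (v ∷ w ∷ ps) → IsPath (p ∷ v ∷ w ∷ ps)
  path-∷ {p} {v} {w} {ps} pv p≢w (u , l) = ¬Any⇒All¬ _ p∉ ∷ u , pv ∷ l
    where
    p∉ : p ∉ v ∷ w ∷ ps
    p∉ (here p≡v) = E⇒≢ pv p≡v
    p∉ (there (here p≡w)) = p≢w p≡w
    p∉ (there (there p∈)) = ¬back-edge (u , l) p∈ pv

  path : ∀ a b → Σ (List V) λ ps → IsPath (a ∷ ps) × last (a ∷ ps) ≡ just b
  path a b = let ps , p , ends , _ = walk⇒path (proj₂ (star⇒walk (connected a b))) in ps , p , ends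

  -- Two vertices are adjacent iff the path between them has a single edge.
  E? : ∀ a b → Dec (E a b)
  E? a b with path a b
  ... | [] , _ , ends = no λ ab → E⇒≢ ab (just-injective ends)
  ... | c ∷ [] , (_ , (ac ∷ [-])) , ends = yes (subst (E a) (just-injective ends) ac)
  ... | c ∷ d ∷ ps , p , ends = no λ ab → ¬back-edge p (last-∈ {xs = d ∷ ps} ends) (E-sym ab)

  opaque
    neighbours : V → List V
    neighbours v = filter (E? v) (allFin n)

    ∈-neighbours⁻ : ∀ {v w} → w ∈ neighbours v → E v w
    ∈-neighbours⁻ {v} w∈ = proj₂ (∈-filter⁻ (E? v) {xs = allFin n} w∈)

    ∈-neighbours⁺ : ∀ {v w} → E v w → w ∈ neighbours v
    ∈-neighbours⁺ {v} {w} vw = ∈-filter⁺ (E? v) (∈-allFin w) vw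

    neighbours-unique : ∀ {v} → Unique (neighbours v)
    neighbours-unique {v} = filter⁺ (E? v) (allFin⁺ n)

  opaque
    without : Maybe V → List V → List V
    without nothing xs = xs
    without (just q) xs = filter (λ w → ¬? (w ≟ q)) xs

    ∈-without⁻ : ∀ {m x xs} → x ∈ without m xs → x ∈ xs × m ≢ just x
    ∈-without⁻ {nothing} x∈ = x∈ , λ ()
    ∈-without⁻ {just q} x∈ with ∈-filter⁻ (λ w → ¬? (w ≟ q)) x∈
    ... | x∈xs , x≢q = x∈xs , λ e → x≢q (≡.sym (just-injective e))

    ∈-without⁺ : ∀ {m x xs} → x ∈ xs → m ≢ just x → x ∈ without m xs
    ∈-without⁺ {nothing} x∈ _ = x∈
    ∈-without⁺ {just q} x∈ m≢x = ∈-filter⁺ (λ w → ¬? (w ≟ q)) x∈ (λ e → m≢x (cong just (≡.sym e)))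

    without-unique : ∀ {m xs} → Unique xs → Unique (without m xs)
    without-unique {nothing} u = u
    without-unique {just q} u = filter⁺ (λ w → ¬? (w ≟ q)) u

  children : Maybe V → V → List V
  children m v = without m (neighbours v)

  ∈-children⁻ : ∀ {m v w} → w ∈ children m v → E v w × m ≢ just w
  ∈-children⁻ w∈ = let w∈nb , m≢w = ∈-without⁻ w∈ in ∈-neighbours⁻ w∈nb , m≢w

  ∈-children⁺ : ∀ {m v w} → E v w → m ≢ just w → w ∈ children m v
  ∈-children⁺ vw m≢w = ∈-without⁺ (∈-neighbours⁺ vw) m≢w

  child⇒E : ∀ {m v w} → w ∈ children m v → E v w
  child⇒E = proj₁ ∘ ∈-children⁻

  children-unique : ∀ {m v} → Unique (children m v)
  children-unique = without-unique neighbours-unique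

  -- The vertices reachable from v by paths of at most f edges not returning to p.
  branchUpTo : ℕ → V → V → List V
  branchUpTo zero p v = v ∷ []
  branchUpTo (suc f) p v = v ∷ concatMap (branchUpTo f v) (children (just p) v)

  branchUpTo-path : ∀ f {p v a} → E p v → a ∈ branchUpTo f p v →
    Σ (List V) λ ps → IsPath (p ∷ v ∷ ps) × last (v ∷ ps) ≡ just a
  branchUpTo-path zero pv (here refl) = [] , edge-path pv , refl
  branchUpTo-path (suc f) pv (here refl) = [] , edge-path pv , refl
  branchUpTo-path (suc f) {p} {v} pv (there a∈) with concatMap-∈⁻ (branchUpTo f v) a∈
  ... | w , w∈ , a∈′ with ∈-children⁻ w∈
  ... | vw , p≢w with branchUpTo-path f vw a∈′
  ... | ps , path′ , ends = w ∷ ps , path-∷ pv (p≢w ∘ cong just) path′ , ends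

  ∉-branchUpTo : ∀ f {v w} → E v w → v ∉ branchUpTo f v w
  ∉-branchUpTo f vw v∈ with branchUpTo-path f vw v∈
  ... | _ , (u , _) , ends = Unique[x∷xs]⇒x∉xs u (last-∈ ends)

  -- A common vertex would give two paths from v that close up into a cycle.
  branchUpTo-disjoint : ∀ f f′ {v w w′ a} → E v w → E v w′ → w ≢ w′ →
                        a ∈ branchUpTo f v w → a ∈ branchUpTo f′ v w′ → ⊥
  branchUpTo-disjoint f f′ {v} {w} {w′} vw vw′ w≢w′ a∈ a∈′
    with branchUpTo-path f vw a∈ | branchUpTo-path f′ vw′ a∈′
  ... | ps , (u , _ ∷ l) , ends | ps′ , (u′ , _ ∷ l′) , ends′ with walk-reverse (linked⇒walk l′ ends′)
  ... | rs , back , rs⊆ with walk⇒path (walk-++ (linked⇒walk l ends) back)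
  ... | qs , (uq , lq) , endsq , qs⊆ = ¬back-edge (¬Any⇒All¬ _ v∉ ∷ uq , vw ∷ lq) w′∈ (E-sym vw′)
    where
    v∉ : v ∉ w ∷ qs
    v∉ (here v≡w) = E⇒≢ vw v≡w
    v∉ (there v∈) with ∈-++⁻ ps (qs⊆ v∈)
    ... | inj₁ v∈ps = Unique[x∷xs]⇒x∉xs u (there v∈ps)
    ... | inj₂ v∈rs = Unique[x∷xs]⇒x∉xs u′ (rs⊆ v∈rs)
    w′∈ : w′ ∈ qs
    w′∈ with last-∈ {xs = w ∷ qs} endsq
    ... | here w′≡w = ⊥-elim (w≢w′ (≡.sym w′≡w))
    ... | there w′∈qs = w′∈qs

  branchUpTo-unique : ∀ f {p v} → E p v → Unique (branchUpTo f p v)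
  branchUpTo-unique zero pv = [] ∷ []
  branchUpTo-unique (suc f) {p} {v} pv =
    ¬Any⇒All¬ _ v∉ ∷ unique-concatMap (branchUpTo f v) children-unique
      (λ w∈ → branchUpTo-unique f (child⇒E w∈))
      (λ w∈ w′∈ → branchUpTo-disjoint f f (child⇒E w∈) (child⇒E w′∈))
    where
    v∉ : v ∉ concatMap (branchUpTo f v) (children (just p) v)
    v∉ v∈ = let w , w∈ , v∈′ = concatMap-∈⁻ (branchUpTo f v) v∈ in
            ∉-branchUpTo f (child⇒E w∈) v∈′

  PathsBounded : ℕ → V → V → Set
  PathsBounded f p v = ∀ ps → IsPath (p ∷ v ∷ ps) → length ps ≤ f

  branchUpTo-suc : ∀ f {p v} → E p v → PathsBounded f p v → branchUpTo (suc f) p v ≡ branchUpTo f p v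
  branchUpTo-suc zero {p} {v} pv bounded with children (just p) v in eq
  ... | [] = refl
  ... | w ∷ _ with ∈-children⁻ (subst (w ∈_) (≡.sym eq) (here refl))
  ... | vw , p≢w with bounded (w ∷ []) (path-∷ pv (p≢w ∘ cong just) (edge-path vw))
  ... | ()
  branchUpTo-suc (suc f) {p} {v} pv bounded =
    cong (v ∷_) (concatMap-cong-∈ (children (just p) v) λ w∈ →
      let vw , p≢w = ∈-children⁻ w∈ in
      branchUpTo-suc f vw λ ps path′ → ≤-pred (bounded (_ ∷ ps) (path-∷ pv (p≢w ∘ cong just) path′)))

  path⇒∈branchUpTo : ∀ f {v w ps a} → IsPath (v ∷ w ∷ ps) → length ps ≤ f →
                     last (w ∷ ps) ≡ just a → a ∈ branchUpTo f v w
  path⇒∈branchUpTo zero {ps = []} _ _ refl = here refl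
  path⇒∈branchUpTo (suc f) {ps = []} _ _ refl = here refl
  path⇒∈branchUpTo (suc f) {v} {w} {x ∷ ps} (u , _ ∷ (wx ∷ l)) (s≤s bound) ends =
    there (∈-concatMap (branchUpTo f w) (∈-children⁺ wx v≢x)
            (path⇒∈branchUpTo f (unique-tail u , wx ∷ l) bound ends))
    where
    v≢x : just v ≢ just x
    v≢x e = Unique[x∷xs]⇒x∉xs u (there (here (just-injective e)))

  -- branch p v: the component of T − pv containing v
  opaque
    branch : V → V → List V
    branch = branchUpTo n

  opaque
    unfolding branch
    branch≡branchUpTo : ∀ {p v} → branch p v ≡ branchUpTo n p v
    branch≡branchUpTo = refl

  subtree : Maybe V → V → List V
  subtree m v = v ∷ concatMap (branch v) (children m v)

  paths-bounded : ∀ {p v} → PathsBounded n p v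
  paths-bounded ps (u , _) = ≤-trans (n≤1+n _) (≤-trans (n≤1+n _) (unique⇒length≤ u))

  branch-unfold : ∀ {p v} → E p v → branch p v ≡ subtree (just p) v
  branch-unfold {p} {v} pv = begin
    branch p v
      ≡⟨ branch≡branchUpTo ⟩
    branchUpTo n p v
      ≡⟨ ≡.sym (branchUpTo-suc n pv paths-bounded) ⟩
    v ∷ concatMap (branchUpTo n v) (children (just p) v)
      ≡⟨ cong (v ∷_) (concatMap-cong-∈ (children (just p) v) λ _ → ≡.sym branch≡branchUpTo) ⟩
    subtree (just p) v ∎
    where open ≡.≡-Reasoning

  branch-unique : ∀ {p v} → E p v → Unique (branch p v)
  branch-unique pv = subst Unique (≡.sym branch≡branchUpTo) (branchUpTo-unique n pv)

  ∉-branch : ∀ {v w} → E v w → v ∉ branch v w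
  ∉-branch vw v∈ = ∉-branchUpTo n vw (subst (_ ∈_) branch≡branchUpTo v∈)

  branch-disjoint : ∀ {v w w′ a} → E v w → E v w′ → w ≢ w′ → a ∈ branch v w → a ∈ branch v w′ → ⊥
  branch-disjoint vw vw′ w≢w′ a∈ a∈′ =
    branchUpTo-disjoint n n vw vw′ w≢w′
      (subst (_ ∈_) branch≡branchUpTo a∈) (subst (_ ∈_) branch≡branchUpTo a∈′)

  root∈branch : ∀ {p v} → E p v → v ∈ branch p v
  root∈branch pv = subst (_ ∈_) (≡.sym (branch-unfold pv)) (here refl)

  ∈-branch-subtree : ∀ {m v w a} → w ∈ children m v → a ∈ branch v w → a ∈ subtree m v
  ∈-branch-subtree {v = v} w∈ a∈ = there (∈-concatMap (branch v) w∈ a∈)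

  ∈-subtree-nothing : ∀ v a → a ∈ subtree nothing v
  ∈-subtree-nothing v a with path v a
  ... | [] , _ , refl = here refl
  ... | w ∷ ps , (u , vw ∷ l) , ends =
    ∈-branch-subtree (∈-children⁺ vw λ ()) (subst (_ ∈_) (≡.sym branch≡branchUpTo)
      (path⇒∈branchUpTo n (u , vw ∷ l) (paths-bounded ps (u , vw ∷ l)) ends))

  branch-closed : ∀ {x z b w} → E x z → b ∈ branch x z → E b w → w ∈ branch x z ⊎ w ≡ x
  branch-closed xz = go _ ≤-refl xz
    where
    go : ∀ s {x z b w} → length (branch x z) ≤ s → E x z → b ∈ branch x z → E b w → w ∈ branch x z ⊎ w ≡ x
    go zero bound xz _ _ with subst (λ t → length t ≤ 0) (branch-unfold xz) bound
    ... | ()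
    go (suc s) {x} {z} {b} {w} bound xz b∈ bw with subst (b ∈_) (branch-unfold xz) b∈
    ... | here refl with w ≟ x
    ...   | yes w≡x = inj₂ w≡x
    ...   | no w≢x = inj₁ (subst (w ∈_) (≡.sym (branch-unfold xz))
                        (∈-branch-subtree (∈-children⁺ bw (λ e → w≢x (≡.sym (just-injective e)))) (root∈branch bw)))
    go (suc s) {x} {z} {b} {w} bound xz b∈ bw | there b∈′ with concatMap-∈⁻ (branch z) b∈′
    ... | y , y∈ , b∈y with go s (≤-trans (length-∈-concatMap (branch z) y∈)
                                   (≤-pred (subst (λ t → length t ≤ suc s) (branch-unfold xz) bound)))
                                 (child⇒E y∈) b∈y bw
    ...   | inj₁ w∈y = inj₁ (subst (w ∈_) (≡.sym (branch-unfold xz)) (∈-branch-subtree y∈ w∈y))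
    ...   | inj₂ refl = inj₁ (root∈branch xz)

  root∈branchUpTo : ∀ f {p v} → v ∈ branchUpTo f p v
  root∈branchUpTo zero = here refl
  root∈branchUpTo (suc f) = here refl

  branchUpTo-connected : ∀ f {p v a} → a ∈ branchUpTo f p v → Star (Within E (branchUpTo f p v)) v a
  branchUpTo-connected zero (here refl) = ε
  branchUpTo-connected (suc f) (here refl) = ε
  branchUpTo-connected (suc f) {p} {v} (there a∈) with concatMap-∈⁻ (branchUpTo f v) a∈
  ... | w , w∈ , a∈′ = (child⇒E w∈ , here refl , widen (root∈branchUpTo f)) ◅
                       Star.map (λ (e , u∈ , u′∈) → e , widen u∈ , widen u′∈) (branchUpTo-connected f a∈′)
    where
    widen : ∀ {x} → x ∈ branchUpTo f v w → x ∈ branchUpTo (suc f) p v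
    widen x∈ = there (∈-concatMap (branchUpTo f v) w∈ x∈)

  branch-connected : ∀ {p v a} → a ∈ branch p v → Star (Within E (branch p v)) v a
  branch-connected {p} {v} {a} a∈ = subst (λ X → Star (Within E X) v a) (≡.sym branch≡branchUpTo)
    (branchUpTo-connected n (subst (a ∈_) branch≡branchUpTo a∈))

module Spine {n : ℕ} (T : Graph n) (connected : Connected T) (acyclic : Acyclic T)
  (M : ℕ) (small : n ≤ 3 * (2 + M)) where

  open Tree T connected acyclic

  size : V → V → ℕ
  size p v = length (branch p v)

  size-positive : ∀ {p v} → E p v → 1 ≤ size p v
  size-positive pv = subst (λ t → 1 ≤ length t) (≡.sym (branch-unfold pv)) (s≤s z≤n)

  size≤n : ∀ {p v} → E p v → size p v ≤ n
  size≤n pv = unique⇒length≤ (branch-unique pv)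

  size-child : ∀ {p v w} → E p v → w ∈ children (just p) v → suc (size v w) ≤ size p v
  size-child {v = v} pv w∈ =
    subst (λ t → _ ≤ length t) (≡.sym (branch-unfold pv)) (s≤s (length-∈-concatMap (branch v) w∈))

  size-sum≤n : ∀ {x ys} → Unique ys → (∀ {y} → y ∈ ys → E x y) → suc (sum (map (size x) ys)) ≤ n
  size-sum≤n {x} {ys} u adj = subst (λ t → suc t ≤ n) (length-concatMap (branch x) ys)
    (unique⇒length≤ {xs = x ∷ concatMap (branch x) ys} (¬Any⇒All¬ _ x∉ ∷ unique-concatMap (branch x) u
      (branch-unique ∘ adj) (λ y∈ y′∈ → branch-disjoint (adj y∈) (adj y′∈))))
    where
    x∉ : x ∉ concatMap (branch x) ys
    x∉ x∈ = let y , y∈ , x∈′ = concatMap-∈⁻ (branch x) x∈ in ∉-branch (adj y∈) x∈′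

  no-three-large : ∀ {x y₁ y₂ y₃} → E x y₁ → E x y₂ → E x y₃ → y₁ ≢ y₂ → y₁ ≢ y₃ → y₂ ≢ y₃ →
                   2 + M ≤ size x y₁ → 2 + M ≤ size x y₂ → 2 + M ≤ size x y₃ → ⊥
  no-three-large {x} {y₁} {y₂} {y₃} xy₁ xy₂ xy₃ y₁≢y₂ y₁≢y₃ y₂≢y₃ l₁ l₂ l₃ =
    ≤⇒≯ small (≤-trans (s≤s (+-mono-≤ l₁ (+-mono-≤ l₂ (+-mono-≤ l₃ ≤-refl))))
                       (size-sum≤n ((y₁≢y₂ ∷ y₁≢y₃ ∷ []) ∷ (y₂≢y₃ ∷ []) ∷ [] ∷ []) adj))
    where
    adj : ∀ {y} → y ∈ y₁ ∷ y₂ ∷ y₃ ∷ [] → E x y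
    adj (here refl) = xy₁
    adj (there (here refl)) = xy₂
    adj (there (there (here refl))) = xy₃

  -- A heavy x cannot hang off the spine: a branch below it is too large for the smaller case.
  Heavy : V → V → Set
  Heavy p x = Any (λ z → M < size x z) (children (just p) x)

  Heavy? : ∀ p x → Dec (Heavy p x)
  Heavy? p x = any? (λ z → M <? size x z) (children (just p) x)

  heavy⇒large : ∀ {p x} → E p x → Heavy p x → 2 + M ≤ size p x
  heavy⇒large px h = let z , z∈ , large = find h in
    ≤-trans (s≤s large) (size-child px z∈)

  data HeavyChildren (m : Maybe V) (x : V) : Set where
    none : (∀ {y} → y ∈ children m x → ¬ Heavy x y) → HeavyChildren m x
    one  : ∀ {y} → y ∈ children m x → Heavy x y →
           (∀ {y′} → y′ ∈ children m x → Heavy x y′ → y′ ≡ y) → HeavyChildren m x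
    two  : ∀ {y₁ y₂} → y₁ ∈ children m x → y₂ ∈ children m x → y₁ ≢ y₂ →
           Heavy x y₁ → Heavy x y₂ → HeavyChildren m x

  heavyChildren : ∀ m x → HeavyChildren m x
  heavyChildren m x with filter (Heavy? x) (children m x) in eq
  ... | [] = none λ y∈ h → ∉[] (subst (_ ∈_) eq (∈-filter⁺ (Heavy? x) y∈ h))
  ... | y ∷ [] = let y∈ , h = ∈-filter⁻ (Heavy? x) (subst (y ∈_) (≡.sym eq) (here refl)) in
    one y∈ h λ y′∈ h′ → only (subst (_ ∈_) eq (∈-filter⁺ (Heavy? x) y′∈ h′))
    where
    only : ∀ {y′} → y′ ∈ y ∷ [] → y′ ≡ y
    only (here refl) = refl
  ... | y₁ ∷ y₂ ∷ _ =
    let y₁∈ , h₁ = ∈-filter⁻ (Heavy? x) (subst (y₁ ∈_) (≡.sym eq) (here refl))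
        y₂∈ , h₂ = ∈-filter⁻ (Heavy? x) (subst (y₂ ∈_) (≡.sym eq) (there (here refl)))
    in two y₁∈ y₂∈ y₁≢y₂ h₁ h₂
    where
    y₁≢y₂ : y₁ ≢ y₂
    y₁≢y₂ with subst Unique eq (filter⁺ (Heavy? x) children-unique)
    ... | (y₁≢ ∷ _) ∷ _ = y₁≢

  Settled : Maybe V → Maybe V → V → Set
  Settled m m′ p = ∀ {x} → E p x → m ≢ just x → m′ ≢ just x → ¬ Heavy p x

  -- Spine m ps: ps is a path leaving m whose vertices have no heavy neighbours off the path.
  data Spine : Maybe V → List V → Set where
    end  : ∀ {m p} → Settled m nothing p → Spine m (p ∷ [])
    step : ∀ {m p q ps} → E p q → m ≢ just q → Settled m (just q) p →
           Spine (just p) (q ∷ ps) → Spine m (p ∷ q ∷ ps)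

  spine-join : ∀ {p x xs ys} → Spine (just p) (x ∷ xs) → E p x → Spine (just x) (p ∷ ys) →
               Spine nothing (xs ʳ++ x ∷ p ∷ ys)
  spine-join (end settled) px s = step (E-sym px) (λ ()) (λ xy a b → settled xy b a) s
  spine-join (step xy p≢y settled s′) px s =
    spine-join s′ xy (step (E-sym px) (p≢y ∘ ≡.sym) (λ xz a b → settled xz b a) s)

  -- The large branch behind x leaves x at most one heavy child.
  arm : ∀ f {p x} → E p x → size p x ≤ f → 2 + M ≤ size x p → Σ (List V) λ ps → Spine (just p) (x ∷ ps)
  arm zero px bound _ with ≤-trans (size-positive px) bound
  ... | ()
  arm (suc f) {p} {x} px bound large with heavyChildren (just p) x
  ... | none ¬heavy = [] , end λ xy p≢y _ → ¬heavy (∈-children⁺ xy p≢y)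
  ... | one {y} y∈ heavy only =
    let xy , p≢y = ∈-children⁻ y∈
        ps , s = arm f xy (≤-pred (≤-trans (size-child px y∈) bound))
                   (≤-trans large (≤-trans (n≤1+n _)
                      (size-child (E-sym xy) (∈-children⁺ (E-sym px) (p≢y ∘ ≡.sym)))))
    in y ∷ ps , step xy p≢y (λ xz p≢z y≢z h → y≢z (cong just (≡.sym (only (∈-children⁺ xz p≢z) h)))) s
  ... | two y₁∈ y₂∈ y₁≢y₂ h₁ h₂ =
    let xy₁ , p≢y₁ = ∈-children⁻ y₁∈
        xy₂ , p≢y₂ = ∈-children⁻ y₂∈
    in ⊥-elim (no-three-large (E-sym px) xy₁ xy₂ (p≢y₁ ∘ cong just) (p≢y₂ ∘ cong just) y₁≢y₂
                 large (heavy⇒large xy₁ h₁) (heavy⇒large xy₂ h₂))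

  -- Two heavy neighbours of c: grow arms into both and join them through c.
  fork : ∀ {c y₁ y₂} → E c y₁ → E c y₂ → y₁ ≢ y₂ → Heavy c y₁ → Heavy c y₂ → Σ (List V) (Spine nothing)
  fork {c} {y₁} {y₂} cy₁ cy₂ y₁≢y₂ h₁ h₂ =
    let _ , s₁ = arm n cy₁ (size≤n cy₁) (behind cy₁ cy₂ y₁≢y₂ h₂)
        _ , s₂ = arm n cy₂ (size≤n cy₂) (behind cy₂ cy₁ (y₁≢y₂ ∘ ≡.sym) h₁)
    in _ , spine-join s₁ cy₁ (step cy₂ (y₁≢y₂ ∘ just-injective) settled s₂)
    where
    behind : ∀ {y y′} → E c y → E c y′ → y ≢ y′ → Heavy c y′ → 2 + M ≤ size y c
    behind cy cy′ y≢y′ h′ =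
      ≤-trans (heavy⇒large cy′ h′)
        (≤-trans (n≤1+n _) (size-child (E-sym cy) (∈-children⁺ cy′ (y≢y′ ∘ just-injective))))
    settled : Settled (just y₁) (just y₂) c
    settled cz y₁≢z y₂≢z h = no-three-large cy₁ cy₂ cz y₁≢y₂ (y₁≢z ∘ cong just) (y₂≢z ∘ cong just)
      (heavy⇒large cy₁ h₁) (heavy⇒large cy₂ h₂) (heavy⇒large cz h)

  -- Move from c towards its only heavy neighbour x until a vertex with two heavy sides is found.
  walk : ∀ f {c x} → E c x → (∀ {y} → E c y → y ≢ x → ¬ Heavy c y) → size c x ≤ f → Σ (List V) (Spine nothing)
  walk zero cx _ bound with ≤-trans (size-positive cx) bound
  ... | ()
  walk (suc f) {c} {x} cx onlyX bound with heavyChildren (just c) x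
  ... | none ¬heavy =
    _ , step cx (λ ()) (λ cy _ x≢y → onlyX cy (x≢y ∘ cong just ∘ ≡.sym))
                       (end λ xy c≢y _ → ¬heavy (∈-children⁺ xy c≢y))
  ... | two y₁∈ y₂∈ y₁≢y₂ h₁ h₂ = fork (child⇒E y₁∈) (child⇒E y₂∈) y₁≢y₂ h₁ h₂
  ... | one {y} y∈ heavy onlyY with ∈-children⁻ y∈ | Heavy? x c
  ...   | xy , c≢y | yes heavy-c = fork (E-sym cx) xy (c≢y ∘ cong just) heavy-c heavy
  ...   | xy , c≢y | no ¬heavy-c = walk f xy onlyY′ (≤-pred (≤-trans (size-child cx y∈) bound))
    where
    onlyY′ : ∀ {y′} → E x y′ → y′ ≢ y → ¬ Heavy x y′
    onlyY′ {y′} xy′ y′≢y h with y′ ≟ c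
    ... | yes refl = ¬heavy-c h
    ... | no y′≢c = y′≢y (onlyY (∈-children⁺ xy′ (y′≢c ∘ ≡.sym ∘ just-injective)) h)

  spine : V → Σ (List V) (Spine nothing)
  spine r with heavyChildren nothing r
  ... | none ¬heavy = _ , end λ ry _ _ → ¬heavy (∈-children⁺ ry λ ())
  ... | one {x} x∈ _ onlyX = walk n (child⇒E x∈) onlyX′ (size≤n (child⇒E x∈))
    where
    onlyX′ : ∀ {y} → E r y → y ≢ x → ¬ Heavy r y
    onlyX′ ry y≢x h = y≢x (onlyX (∈-children⁺ ry λ ()) h)
  ... | two y₁∈ y₂∈ y₁≢y₂ h₁ h₂ = fork (child⇒E y₁∈) (child⇒E y₂∈) y₁≢y₂ h₁ h₂

module Caterpillar {n : ℕ} (T : Graph n) (connected : Connected T) (acyclic : Acyclic T)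
  (M : ℕ) (small : n ≤ 3 * (2 + M)) {k : ℕ}
  (layoutSmall : ∀ {x z} → Adj T x z → Spine.size T connected acyclic M small x z ≤ M →
                 LayoutOf (Adj T) (Tree.branch T connected acyclic x z) k) where

  open Tree T connected acyclic
  open Spine T connected acyclic M small
  open IsLayoutOf

  smallLayout : V → V → Layout V k
  smallLayout x z with E? x z | size x z ≤? M
  ... | yes xz | yes ≤M = proj₁ (layoutSmall xz ≤M)
  ... | _ | _ = []

  smallLayout-spec : ∀ {x z} → E x z → size x z ≤ M → IsLayoutOf E (branch x z) (smallLayout x z)
  smallLayout-spec {x} {z} xz ≤M with E? x z | size x z ≤? M
  ... | yes xz′ | yes ≤M′ = proj₂ (layoutSmall xz′ ≤M′)
  ... | no ¬xz | _ = ⊥-elim (¬xz xz)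
  ... | yes _ | no ≰M = ⊥-elim (≰M ≤M)

  smallLayout-sound : ∀ {x z a} → E x z → a ∈ vertices (smallLayout x z) → a ∈ branch x z
  smallLayout-sound {x} {z} xz a∈ with E? x z | size x z ≤? M
  ... | yes xz′ | yes ≤M = sound (proj₂ (layoutSmall xz′ ≤M)) a∈
  ... | yes _ | no _ = ⊥-elim (∉[] a∈)
  ... | no ¬xz | _ = ⊥-elim (¬xz xz)

  ¬heavy⇒small : ∀ {p x z} → ¬ Heavy p x → z ∈ children (just p) x → size x z ≤ M
  ¬heavy⇒small {x = x} {z} ¬heavy z∈ with M <? size x z
  ... | yes large = ⊥-elim (¬heavy (lose z∈ large))
  ... | no ¬large = ≮⇒≥ ¬large

  blocks : V → V → Layout V (suc k)
  blocks p x = concatMap (shift ∘ smallLayout x) (children (just p) x)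

  pendant : V → V → Layout V (suc k)
  pendant p x = (x , zero) ∷ blocks p x

  vertices-blocks : ∀ {p x} → vertices (blocks p x) ≡ concatMap (vertices ∘ smallLayout x) (children (just p) x)
  vertices-blocks {p} {x} = ≡.trans (vertices-concatMap (shift ∘ smallLayout x) (children (just p) x))
    (concatMap-cong-∈ (children (just p) x) λ _ → vertices-shift _)

  ∈-blocks⁻ : ∀ {p x a} → a ∈ vertices (blocks p x) → ∃ λ z → z ∈ children (just p) x × a ∈ branch x z
  ∈-blocks⁻ {p} {x} a∈ with concatMap-∈⁻ (vertices ∘ smallLayout x) (subst (_ ∈_) (vertices-blocks {p}) a∈)
  ... | z , z∈ , a∈′ = z , z∈ , smallLayout-sound (child⇒E z∈) a∈′

  x∉blocks : ∀ {p x} → x ∉ vertices (blocks p x)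
  x∉blocks x∈ = let z , z∈ , x∈′ = ∈-blocks⁻ x∈ in ∉-branch (child⇒E z∈) x∈′

  blocks≢zero : ∀ {p x b} → b ∈ blocks p x → proj₂ b ≢ zero
  blocks≢zero {p} {x} b∈ =
    shift≢zero (proj₂ (proj₂ (concatMap-∈⁻ (shift ∘ smallLayout x) {xs = children (just p) x} b∈)))

  ∈-pendant⁻ : ∀ {p x a} → E p x → a ∈ vertices (pendant p x) → a ∈ branch p x
  ∈-pendant⁻ px (here refl) = root∈branch px
  ∈-pendant⁻ px (there a∈) = let z , z∈ , a∈′ = ∈-blocks⁻ a∈ in
    subst (_ ∈_) (≡.sym (branch-unfold px)) (∈-branch-subtree z∈ a∈′)

  module Pendant {p x : V} (px : E p x) (¬heavy : ¬ Heavy p x) where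

    spec : ∀ {z} → z ∈ children (just p) x → IsLayoutOf E (branch x z) (smallLayout x z)
    spec z∈ = smallLayout-spec (child⇒E z∈) (¬heavy⇒small ¬heavy z∈)

    ∈-blocks⁺ : ∀ {a z} → z ∈ children (just p) x → a ∈ branch x z → a ∈ vertices (blocks p x)
    ∈-blocks⁺ z∈ a∈ = subst (_ ∈_) (≡.sym vertices-blocks)
      (∈-concatMap (vertices ∘ smallLayout x) z∈ (complete (spec z∈) a∈))

    blocks-unique : Unique (vertices (blocks p x))
    blocks-unique = subst Unique (≡.sym vertices-blocks) (unique-concatMap (vertices ∘ smallLayout x)
      children-unique (unique ∘ spec)
      (λ z∈ z′∈ z≢z′ a∈ a∈′ → branch-disjoint (child⇒E z∈) (child⇒E z′∈) z≢z′
                                (sound (spec z∈) a∈) (sound (spec z′∈) a∈′)))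

    blocks-consistent : Consistent E (blocks p x)
    blocks-consistent = consistent-concatMap E (shift ∘ smallLayout x) children-unique
      (consistent-shift ∘ consistent ∘ spec) no-edge
      where
      in-branch : ∀ {z a} → z ∈ children (just p) x → a ∈ shift (smallLayout x z) → proj₁ a ∈ branch x z
      in-branch z∈ a∈ = sound (spec z∈) (subst (_ ∈_) (vertices-shift _) (∈-map⁺ proj₁ a∈))
      no-edge : ∀ {z z′ a b} → z ∈ children (just p) x → z′ ∈ children (just p) x → z ≢ z′ →
                a ∈ shift (smallLayout x z) → b ∈ shift (smallLayout x z′) → ¬ E (proj₁ a) (proj₁ b)
      no-edge z∈ z′∈ z≢z′ a∈ b∈ ab with branch-closed (child⇒E z∈) (in-branch z∈ a∈) ab
      ... | inj₁ b∈z = branch-disjoint (child⇒E z∈) (child⇒E z′∈) z≢z′ b∈z (in-branch z′∈ b∈)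
      ... | inj₂ refl = ∉-branch (child⇒E z′∈) (in-branch z′∈ b∈)

    blocks-closed : ∀ {b w} → b ∈ blocks p x → E (proj₁ b) w → w ∈ vertices (blocks p x) ⊎ w ≡ x
    blocks-closed b∈ bw with ∈-blocks⁻ (∈-map⁺ proj₁ b∈)
    ... | z , z∈ , b∈z with branch-closed (child⇒E z∈) b∈z bw
    ...   | inj₁ w∈z = inj₁ (∈-blocks⁺ z∈ w∈z)
    ...   | inj₂ w≡x = inj₂ w≡x

    ∈-pendant⁺ : ∀ {a} → a ∈ branch p x → a ∈ vertices (pendant p x)
    ∈-pendant⁺ a∈ with subst (_ ∈_) (branch-unfold px) a∈
    ... | here refl = here refl
    ... | there a∈′ = let z , z∈ , a∈z = concatMap-∈⁻ (branch x) a∈′ in there (∈-blocks⁺ z∈ a∈z)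

    pendant-unique : Unique (vertices (pendant p x))
    pendant-unique = ¬Any⇒All¬ _ x∉blocks ∷ blocks-unique

  segment : V → List V → Layout V (suc k) → Layout V (suc k)
  segment p xs R = concatMap (pendant p) xs ++ (p , zero) ∷ R

  Legs : V → List V → Set
  Legs p xs = Unique xs × (∀ {x} → x ∈ xs → E p x × ¬ Heavy p x)

  vertices-segment : ∀ p xs R →
    vertices (segment p xs R) ≡ concatMap (vertices ∘ pendant p) xs ++ p ∷ vertices R
  vertices-segment p xs R = ≡.trans (vertices-++ (concatMap (pendant p) xs) ((p , zero) ∷ R))
    (cong (_++ p ∷ vertices R) (vertices-concatMap (pendant p) xs))

  ∈-segment⁻ : ∀ {p xs R a} → (∀ {x} → x ∈ xs → E p x) → a ∈ vertices (segment p xs R) →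
               (∃ λ x → x ∈ xs × a ∈ branch p x) ⊎ a ∈ p ∷ vertices R
  ∈-segment⁻ {p} {xs} {R} adj a∈
    with ∈-++⁻ (concatMap (vertices ∘ pendant p) xs) (subst (_ ∈_) (vertices-segment p xs R) a∈)
  ... | inj₂ a∈′ = inj₂ a∈′
  ... | inj₁ a∈′ = let x , x∈ , a∈x = concatMap-∈⁻ (vertices ∘ pendant p) a∈′ in
    inj₁ (x , x∈ , ∈-pendant⁻ (adj x∈) a∈x)

  ∈-segment⁺ : ∀ {p xs R a} → Legs p xs → (∃ λ x → x ∈ xs × a ∈ branch p x) ⊎ a ∈ p ∷ vertices R →
               a ∈ vertices (segment p xs R)
  ∈-segment⁺ {p} {xs} {R} legs a∈ = subst (_ ∈_) (≡.sym (vertices-segment p xs R)) (go a∈)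
    where
    go : _ ⊎ _ → _
    go (inj₁ (x , x∈ , a∈x)) = let px , ¬heavy = proj₂ legs x∈ in
      ∈-++⁺ˡ (∈-concatMap (vertices ∘ pendant p) x∈ (Pendant.∈-pendant⁺ px ¬heavy a∈x))
    go (inj₂ a∈′) = ∈-++⁺ʳ _ a∈′

  segment-unique : ∀ {p xs R} → Legs p xs → Unique (p ∷ vertices R) →
                   (∀ {a x} → a ∈ vertices R → x ∈ xs → a ∉ branch p x) → Unique (vertices (segment p xs R))
  segment-unique {p} {xs} {R} (u , legs) uR R-apart = subst Unique (≡.sym (vertices-segment p xs R))
    (++⁺ (unique-concatMap (vertices ∘ pendant p) u
           (λ x∈ → let px , ¬heavy = legs x∈ in Pendant.pendant-unique px ¬heavy)
           (λ x∈ x′∈ x≢x′ a∈ a∈′ → branch-disjoint (proj₁ (legs x∈)) (proj₁ (legs x′∈)) x≢x′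
                                     (∈-pendant⁻ (proj₁ (legs x∈)) a∈) (∈-pendant⁻ (proj₁ (legs x′∈)) a∈′)))
         uR apart)
    where
    apart : ∀ {a} → a ∈ concatMap (vertices ∘ pendant p) xs × a ∈ p ∷ vertices R → ⊥
    apart (a∈ , a∈′) with concatMap-∈⁻ (vertices ∘ pendant p) a∈
    ... | x , x∈ , a∈x with ∈-pendant⁻ (proj₁ (legs x∈)) a∈x | a∈′
    ...   | a∈px | here refl = ∉-branch (proj₁ (legs x∈)) a∈px
    ...   | a∈px | there a∈R = R-apart a∈R x∈ a∈px

  -- A class-0 vertex before q in its segment is the foot of a pendant, hence adjacent to q.
  segment-leg-adjacent : ∀ {q xs R v w} → (∀ {x} → x ∈ xs → E q x) → q ∉ vertices R →
    Before (segment q xs R) v w → proj₂ v ≡ zero → proj₁ w ≡ q → E (proj₁ v) q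
  segment-leg-adjacent {q} {xs} {R} adj q∉R b v0 w≡q with before-++⁻ (concatMap (pendant q) xs) b
  ... | inj₁ b′ with concatMap-∈⁻ (pendant q) {xs = xs} (before-∈ʳ b′)
  ...   | x , x∈ , w∈ =
    ⊥-elim (∉-branch (adj x∈) (subst (_∈ branch q x) w≡q (∈-pendant⁻ (adj x∈) (∈-map⁺ proj₁ w∈))))
  segment-leg-adjacent {q} {xs} adj q∉R b v0 w≡q | inj₂ (inj₁ (v∈ , _))
    with concatMap-∈⁻ (pendant q) {xs = xs} v∈
  ... | x , x∈ , here refl = E-sym (adj x∈)
  ... | x , x∈ , there v∈′ = ⊥-elim (blocks≢zero v∈′ v0)
  segment-leg-adjacent {q} {xs} {R} adj q∉R b v0 w≡q | inj₂ (inj₂ b′) =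
    ⊥-elim (q∉R (subst (_∈ vertices R) w≡q (∈-map⁺ proj₁ (before-∷-∈ʳ b′))))

  segment-consistent : ∀ {p} xs {R} → Legs p xs → Unique (p ∷ vertices R) → Consistent E ((p , zero) ∷ R) →
                       (∀ {a x} → a ∈ vertices R → x ∈ xs → a ∉ branch p x) → Consistent E (segment p xs R)
  segment-consistent [] _ _ cR _ = cR
  segment-consistent {p} (x ∷ xs) {R} (u , legs) uR cR R-apart =
    subst (Consistent E) (≡.sym split)
      (consistent-∷ E (consistent-++ E blocks-consistent rest-consistent no-edge) from-x)
    where
    px : E p x
    px = proj₁ (legs (here refl))
    open Pendant px (proj₂ (legs (here refl)))
    S : Layout V (suc k)
    S = segment p xs R
    split : segment p (x ∷ xs) R ≡ (x , zero) ∷ blocks p x ++ S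
    split = cong ((x , zero) ∷_) (++-assoc (blocks p x) (concatMap (pendant p) xs) ((p , zero) ∷ R))
    rest-consistent : Consistent E S
    rest-consistent = segment-consistent xs (unique-tail u , legs ∘ there) uR cR (λ a∈ x∈ → R-apart a∈ (there x∈))
    outside : ∀ {a} → a ∈ vertices S → a ∉ branch p x
    outside a∈ a∈x with ∈-segment⁻ (proj₁ ∘ legs ∘ there) a∈
    ... | inj₁ (x′ , x′∈ , a∈x′) = branch-disjoint px (proj₁ (legs (there x′∈))) (unique-head-≢ u x′∈) a∈x a∈x′
    ... | inj₂ (here refl) = ∉-branch px a∈x
    ... | inj₂ (there a∈R) = R-apart a∈R (here refl) a∈x
    no-edge : ∀ {a b} → a ∈ blocks p x → b ∈ S → ¬ E (proj₁ a) (proj₁ b)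
    no-edge a∈ b∈ ab with blocks-closed a∈ ab
    ... | inj₁ b∈B = outside (∈-map⁺ proj₁ b∈) (∈-pendant⁻ px (there b∈B))
    ... | inj₂ b≡x = outside (∈-map⁺ proj₁ b∈) (subst (_∈ branch p x) (≡.sym b≡x) (root∈branch px))
    from-x : ∀ {v w} → Before (blocks p x ++ S) v w → proj₂ v ≡ zero → E x (proj₁ w) → E (proj₁ v) (proj₁ w)
    from-x b v0 xw with before-++⁻ (blocks p x) b
    ... | inj₁ b′ = ⊥-elim (blocks≢zero (before-∈ˡ b′) v0)
    ... | inj₂ (inj₁ (v∈ , _)) = ⊥-elim (blocks≢zero v∈ v0)
    ... | inj₂ (inj₂ b′) with branch-closed px (root∈branch px) xw
    ...   | inj₁ w∈ = ⊥-elim (outside (∈-map⁺ proj₁ (before-∈ʳ b′)) w∈)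
    ...   | inj₂ w≡p = subst (E _) (≡.sym w≡p)
                         (segment-leg-adjacent (proj₁ ∘ legs ∘ there) (Unique[x∷xs]⇒x∉xs uR) b′ v0 w≡p)

  -- The neighbours of p off the spine, whose neighbours on the spine are m and m′.
  offSpine : Maybe V → Maybe V → V → List V
  offSpine m m′ p = without m′ (children m p)

  offSpine-adj : ∀ {m m′ p x} → x ∈ offSpine m m′ p → E p x
  offSpine-adj x∈ = proj₁ (∈-children⁻ (proj₁ (∈-without⁻ x∈)))

  offSpine-legs : ∀ {m m′ p} → Settled m m′ p → Legs p (offSpine m m′ p)
  offSpine-legs settled = without-unique children-unique , λ x∈ →
    let x∈c , m′≢x = ∈-without⁻ x∈
        px , m≢x = ∈-children⁻ x∈c
    in px , settled px m≢x m′≢x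

  spineLayout : Maybe V → List V → Layout V (suc k)
  spineLayout m [] = []
  spineLayout m (p ∷ ps) = segment p (offSpine m (head ps) p) (spineLayout (just p) ps)

  spineLayout-spec : ∀ {m p ps} → Spine m (p ∷ ps) → IsLayoutOf E (subtree m p) (spineLayout m (p ∷ ps))
  spineLayout-spec {m} {p} (end settled) = record
    { unique = segment-unique legs ([] ∷ []) (λ ())
    ; sound = sound′
    ; complete = complete′
    ; consistent = segment-consistent (offSpine m nothing p) legs ([] ∷ [])
                     (consistent-∷ E (consistent-[] E) λ ()) (λ ()) }
    where
    legs = offSpine-legs settled
    sound′ : ∀ {a} → a ∈ vertices (spineLayout m (p ∷ [])) → a ∈ subtree m p
    sound′ a∈ with ∈-segment⁻ offSpine-adj a∈
    ... | inj₁ (x , x∈ , a∈x) = ∈-branch-subtree (proj₁ (∈-without⁻ x∈)) a∈x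
    ... | inj₂ (here refl) = here refl
    complete′ : ∀ {a} → a ∈ subtree m p → a ∈ vertices (spineLayout m (p ∷ []))
    complete′ (here refl) = ∈-segment⁺ legs (inj₂ (here refl))
    complete′ (there a∈) = let y , y∈ , a∈y = concatMap-∈⁻ (branch p) a∈ in
      ∈-segment⁺ legs (inj₁ (y , ∈-without⁺ y∈ (λ ()) , a∈y))
  spineLayout-spec {m} {p} {q ∷ ps} (step pq m≢q settled s) = record
    { unique = segment-unique legs uR R-apart
    ; sound = sound′
    ; complete = complete′
    ; consistent = segment-consistent (offSpine m (just q) p) legs uR cR R-apart }
    where
    legs = offSpine-legs settled
    R = spineLayout (just p) (q ∷ ps)
    spec = spineLayout-spec s
    inR : ∀ {a} → a ∈ vertices R → a ∈ branch p q
    inR a∈ = subst (_ ∈_) (≡.sym (branch-unfold pq)) (sound spec a∈)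
    uR : Unique (p ∷ vertices R)
    uR = ¬Any⇒All¬ _ (∉-branch pq ∘ inR) ∷ unique spec
    R-apart : ∀ {a x} → a ∈ vertices R → x ∈ offSpine m (just q) p → a ∉ branch p x
    R-apart a∈ x∈ a∈x = branch-disjoint (offSpine-adj x∈) pq (λ { refl → proj₂ (∈-without⁻ x∈) refl }) a∈x (inR a∈)
    q∉rest : q ∉ vertices (spineLayout (just q) ps)
    q∉rest = Unique[x∷xs]⇒x∉xs (unique-++⁻ʳ (concatMap (vertices ∘ pendant q) legs′)
               (subst Unique (vertices-segment q legs′ (spineLayout (just q) ps)) (unique spec)))
      where legs′ = offSpine (just p) (head ps) q
    edge : ∀ {v w} → Before R v w → proj₂ v ≡ zero → E p (proj₁ w) → E (proj₁ v) (proj₁ w)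
    edge {w = w} b v0 pw with proj₁ w ≟ q
    ... | yes w≡q = subst (E _) (≡.sym w≡q) (segment-leg-adjacent offSpine-adj q∉rest b v0 w≡q)
    ... | no w≢q = ⊥-elim (branch-disjoint pw pq w≢q (root∈branch pw) (inR (∈-map⁺ proj₁ (before-∈ʳ b))))
    cR : Consistent E ((p , zero) ∷ R)
    cR = consistent-∷ E (consistent spec) edge
    sound′ : ∀ {a} → a ∈ vertices (spineLayout m (p ∷ q ∷ ps)) → a ∈ subtree m p
    sound′ a∈ with ∈-segment⁻ offSpine-adj a∈
    ... | inj₁ (x , x∈ , a∈x) = ∈-branch-subtree (proj₁ (∈-without⁻ x∈)) a∈x
    ... | inj₂ (here refl) = here refl
    ... | inj₂ (there a∈R) = ∈-branch-subtree (∈-children⁺ pq m≢q) (inR a∈R)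
    complete′ : ∀ {a} → a ∈ subtree m p → a ∈ vertices (spineLayout m (p ∷ q ∷ ps))
    complete′ (here refl) = ∈-segment⁺ legs (inj₂ (here refl))
    complete′ (there a∈) with concatMap-∈⁻ (branch p) a∈
    ... | y , y∈ , a∈y with y ≟ q
    ...   | yes refl = ∈-segment⁺ legs (inj₂ (there (complete spec (subst (_ ∈_) (branch-unfold pq) a∈y))))
    ...   | no y≢q = ∈-segment⁺ legs (inj₁ (y , ∈-without⁺ y∈ (λ e → y≢q (≡.sym (just-injective e))) , a∈y))

  caterpillar : V → LayoutOf E (allFin n) (suc k)
  caterpillar r with spine r
  ... | p ∷ ps , s = let spec = spineLayout-spec s in spineLayout nothing (p ∷ ps) , record
    { unique = unique spec
    ; sound = λ {a} _ → ∈-allFin a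
    ; complete = λ {a} _ → complete spec (∈-subtree-nothing p a)
    ; consistent = consistent spec }

-- The subgraph induced on the vertices of a duplicate-free list X, numbered by their positions in X.
module Induced {n : ℕ} (G : Graph n) (X : List (Fin n)) (X-unique : Unique X) where

  embed : Fin (length X) → Fin n
  embed = lookup X

  G[X] : Graph (length X)
  G[X] = record { Adj = λ i j → Adj G (embed i) (embed j) ; sym = sym G ; irrefl = irrefl G }

  acyclic-induced : Acyclic G → Acyclic G[X]
  acyclic-induced acyclic c = acyclic record
    { x₀ = embed x₀
    ; rest = map embed rest
    ; long = subst (2 ≤_) (≡.sym (length-map embed rest)) long
    ; unique = Unique.map⁺ (lookup-injective X-unique) unique
    ; linked = Linked.map⁺ linked
    ; closes = λ y ends → closes′ y (≡.trans (≡.sym (last-map embed (x₀ ∷ rest))) ends) }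
    where
    open Cycle c
    closes′ : ∀ y → Maybe.map embed (last (x₀ ∷ rest)) ≡ just y → Adj G y (embed x₀)
    closes′ y ends with last (x₀ ∷ rest) in eq
    ... | just y′ = subst (λ t → Adj G t (embed x₀)) (just-injective ends) (closes y′ eq)

  restrict : ∀ {k} → LayoutOf (Adj G[X]) (allFin (length X)) k → LayoutOf (Adj G) X k
  restrict (L , spec) = mapLayout embed id L , record
    { unique = subst Unique (≡.sym (vertices-mapLayout embed id L))
                 (Unique.map⁺ (lookup-injective X-unique) (IsLayoutOf.unique spec))
    ; sound = sound′
    ; complete = complete′
    ; consistent = consistent-mapLayout embed id (IsLayoutOf.consistent spec) }
    where
    sound′ : ∀ {a} → a ∈ vertices (mapLayout embed id L) → a ∈ X
    sound′ a∈ with ∈-map⁻ embed (subst (_ ∈_) (vertices-mapLayout embed id L) a∈)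
    ... | i , _ , refl = ∈-lookup i
    complete′ : ∀ {a} → a ∈ X → a ∈ vertices (mapLayout embed id L)
    complete′ a∈ = subst (_ ∈_) (≡.sym (vertices-mapLayout embed id L))
      (subst (_∈ map embed (vertices L)) (≡.sym (lookup-index a∈))
        (∈-map⁺ embed (IsLayoutOf.complete spec (∈-allFin (index a∈)))))

  module _ {y} (y∈ : y ∈ X) where

    open import Data.List.Membership.DecPropositional (_≟_ {n}) using (_∈?_)

    -- the index of a in X (junk for vertices outside X)
    position : Fin n → Fin (length X)
    position a with a ∈? X
    ... | yes a∈ = index a∈
    ... | no _ = index y∈

    embed-position : ∀ {a} → a ∈ X → embed (position a) ≡ a
    embed-position {a} a∈ with a ∈? X
    ... | yes a∈′ = ≡.sym (lookup-index a∈′)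
    ... | no a∉ = ⊥-elim (a∉ a∈)

    position-embed : ∀ i → position (embed i) ≡ i
    position-embed i = lookup-injective X-unique (embed-position (∈-lookup i))

    connected-induced : (∀ {a} → a ∈ X → Star (Within (Adj G) X) y a) → Connected G[X]
    connected-induced walks i j = subst₂ (Star (Adj G[X])) (position-embed i) (position-embed j)
      (Star.reverse (sym G[X]) (lift (walks (∈-lookup i))) ◅◅ lift (walks (∈-lookup j)))
      where
      lift : ∀ {a b} → Star (Within (Adj G) X) a b → Star (Adj G[X]) (position a) (position b)
      lift = Star.gmap position λ (e , u∈ , v∈) →
        subst₂ (Adj G) (≡.sym (embed-position u∈)) (≡.sym (embed-position v∈)) e

    nonempty : 1 ≤ length X
    nonempty = ≤-trans (s≤s z≤n) (toℕ<n (index y∈))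

3[M+3]≡3[2+M]+3 : ∀ M → 3 * (M + 3) ≡ 3 * (2 + M) + 3
3[M+3]≡3[2+M]+3 = solve-∀

3≤3^suc : ∀ k → 3 ≤ 3 ^ suc k
3≤3^suc k = *-monoʳ-≤ 3 (m^n>0 3 k)

treeLayout : ∀ k {n} (T : Graph n) → IsTree T → n + 3 ≤ 3 ^ suc k → LayoutOf (Adj T) (allFin n) k
treeLayout zero T (1≤n , _) bound with ≤-trans (+-monoˡ-≤ 3 1≤n) bound
... | s≤s (s≤s (s≤s ()))
treeLayout (suc k) {n} T (1≤n , connected , acyclic) bound =
  Caterpillar.caterpillar T connected acyclic M small layoutSmall (fromℕ< 1≤n)
  where
  open Tree T connected acyclic
  M : ℕ
  M = 3 ^ suc k ∸ 3
  M+3≡ : M + 3 ≡ 3 ^ suc k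
  M+3≡ = m∸n+n≡m (3≤3^suc k)
  small : n ≤ 3 * (2 + M)
  small = +-cancelʳ-≤ 3 n (3 * (2 + M))
    (subst (n + 3 ≤_) (≡.trans (cong (3 *_) (≡.sym M+3≡)) (3[M+3]≡3[2+M]+3 M)) bound)
  open Spine T connected acyclic M small using (size)
  layoutSmall : ∀ {x z} → E x z → size x z ≤ M → LayoutOf E (branch x z) k
  layoutSmall {x} {z} xz ≤M =
    restrict (treeLayout k G[X] tree (≤-trans (+-monoˡ-≤ 3 ≤M) (≤-reflexive M+3≡)))
    where
    open Induced T (branch x z) (branch-unique xz)
    tree : IsTree G[X]
    tree = let z∈ = root∈branch xz in
      nonempty z∈ , connected-induced z∈ branch-connected , acyclic-induced acyclic

crossing : ∀ (f : ℕ → ℕ) {N} m → f 0 ≤ N → N < f m → ∃ λ k → f k ≤ N × N < f (suc k)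
crossing f zero f0≤N N<f0 = ⊥-elim (<⇒≱ N<f0 f0≤N)
crossing f {N} (suc m) f0≤N N<fm with N <? f m
... | yes N<fm′ = crossing f m f0≤N N<fm′
... | no ¬N<fm′ = m , ≮⇒≥ ¬N<fm′ , N<fm

n<3^n : ∀ n → n < 3 ^ n
n<3^n zero = s≤s z≤n
n<3^n (suc n) = +-mono-≤ (m^n>0 3 n) (≤-trans (n<3^n n) (m≤m+n (3 ^ n) (3 ^ n + 0)))

corollary16 : (n : ℕ) (T : Graph n) → IsTree T → ThinnessLogBound T (n + 2)
corollary16 n T tree with crossing (3 ^_) (n + 2) (≤-trans (s≤s z≤n) (m≤n+m 2 n)) (n<3^n (n + 2))
... | k , 3^k≤n+2 , n+2<3^suck =
  k , layout⇒IsThin T (treeLayout k T tree n+3≤) , 3^k≤n+2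
  where
  n+3≤ : n + 3 ≤ 3 ^ suc k
  n+3≤ = subst (_≤ 3 ^ suc k) (≡.sym (+-suc n 2)) n+2<3^suck
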